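{- Let $\Lambda$ be an ordinal with a system of fundamental sequences satisfying the Bachmann property, and let $(\xi_n)_{n\in\mathbb N}$ be a sequence of elements of $\Lambda$ such that, for all $n$, $\xi_n[n+1]\leq\xi_{n+1}\leq\xi_n$. Then, for all $n$, $\xi_n\geq\xi_0[1][2]\ldots[n]$.
   Context: A system of fundamental sequences on an ordinal $\Lambda$ is a function $\cdot[\cdot]\colon\Lambda\times\mathbb N\to\Lambda$ such that $\alpha[n]\leq\alpha$ with equality if and only if $\alpha=0$, and $\alpha[n]\leq\alpha[m]$ whenever $n\leq m$. It has the Bachmann property if whenever $\alpha[n]<\beta<\alpha$, it follows that $\alpha[n]\leq\beta[1]$. The expression $\xi_0[1][2]\ldots[n]$ denotes the iterate $(\cdots((\xi_0[1])[2])\cdots)[n]$ (equal to $\xi_0$ when $n=0$). -}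

module Defs where

open import Level using (0ℓ)
open import Data.Nat using (ℕ; zero; suc)
open import Data.Product using (_×_)
open import Data.Sum using (_⊎_)
open import Relation.Binary.PropositionalEquality using (_≡_)
open import Relation.Binary.Core using (Rel)
open import Relation.Binary.Structures using (IsStrictTotalOrder)
open import Induction.WellFounded using (WellFounded)
open import Function.Bundles using (_⇔_)

record Ordinal : Set₁ where
  field
    Carrier : Set
    _<_ : Rel Carrier 0ℓ
    isStrictTotalOrder : IsStrictTotalOrder _≡_ _<_
    wellFounded : WellFounded _<_

  infix 4 _≤_
  _≤_ : Rel Carrier 0ℓ
  α ≤ β = α < β ⊎ α ≡ β

  IsZero : Carrier → Set
  IsZero α = ∀ β → α ≤ β

module _ (Λ : Ordinal) where
  open Ordinal Λ

  -- A system of fundamental sequences  α[n] = fs α n.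
  record IsFundamentalSystem (fs : Carrier → ℕ → Carrier) : Set where
    field
      fs-≤ : ∀ α n → fs α n ≤ α
      fs-≡⇔zero : ∀ α n → (fs α n ≡ α) ⇔ IsZero α
      fs-mono : ∀ α n m → n Data.Nat.≤ m → fs α n ≤ fs α m

  Bachmann : (Carrier → ℕ → Carrier) → Set
  Bachmann fs = ∀ α β n → fs α n < β → β < α → fs α n ≤ fs β 1

iterFS : {A : Set} → (A → ℕ → A) → A → ℕ → A
iterFS fs ξ zero = ξ
iterFS fs ξ (suc n) = fs (iterFS fs ξ n) (suc n)

-- Call T a k-barrier below β when T ≤ β and T ≤ γ[k] for every γ with T < γ ≤ β.
-- The Bachmann property says exactly that α[n] is a k-barrier below α (for 1, n ≤ k),
-- and barriers compose: a barrier below η that is ≤ η, followed by a barrier η below β,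
-- is a barrier below β. By induction, ξ₀[1]…[n] is an (n+1)-barrier below ξₙ: if the
-- previous barrier η equals ξₙ then η[n+1] ≤ ξₙ₊₁ by hypothesis, and otherwise the
-- barrier property applied to γ = ξₙ gives η ≤ ξₙ[n+1] ≤ ξₙ₊₁.
module Submission where

open import Defs
open import Data.Nat as ℕ using (ℕ; suc; z≤n; s≤s)
open import Data.Nat.Properties using (n≤1+n)
open import Data.Product using (_×_; _,_; proj₁; proj₂)
open import Data.Sum using (inj₁; inj₂)
open import Data.Empty using (⊥-elim)
open import Relation.Binary.PropositionalEquality using (_≡_; refl)
open import Relation.Binary.Structures using (IsStrictTotalOrder; IsTotalOrder)
open import Relation.Binary.Definitions using (tri<; tri≈; tri>)
import Relation.Binary.Construct.StrictToNonStrict as NonStrict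

module BachmannBarriers
  (Λ : Ordinal) (fs : Ordinal.Carrier Λ → ℕ → Ordinal.Carrier Λ)
  (fundamental : IsFundamentalSystem Λ fs) (bachmann : Bachmann Λ fs) where

  open Ordinal Λ
  open IsFundamentalSystem fundamental
  open IsStrictTotalOrder isStrictTotalOrder
    using (compare; irrefl; <-respʳ-≈) renaming (trans to <-trans)
  open IsTotalOrder (NonStrict.isTotalOrder _≡_ _<_ isStrictTotalOrder)
    using () renaming (trans to ≤-trans)

  <-≤-trans : ∀ {α β γ} → α < β → β ≤ γ → α < γ
  <-≤-trans = NonStrict.<-≤-trans _≡_ _<_ <-trans <-respʳ-≈

  Barrier : ℕ → Carrier → Carrier → Set
  Barrier k T β = T ≤ β × (∀ γ → T < γ → γ ≤ β → T ≤ fs γ k)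

  barrier-refl : ∀ k β → Barrier k β β
  barrier-refl k β = inj₂ refl , λ γ β<γ γ≤β → ⊥-elim (irrefl refl (<-≤-trans β<γ γ≤β))

  barrier-mono : ∀ {k k′ T β} → k ℕ.≤ k′ → Barrier k T β → Barrier k′ T β
  barrier-mono {k} {k′} k≤k′ (T≤β , guard) =
    T≤β , λ γ T<γ γ≤β → ≤-trans (guard γ T<γ γ≤β) (fs-mono γ k k′ k≤k′)

  barrier-shrink : ∀ {k T β β′} → T ≤ β′ → β′ ≤ β → Barrier k T β → Barrier k T β′
  barrier-shrink T≤β′ β′≤β (_ , guard) = T≤β′ , λ γ T<γ γ≤β′ → guard γ T<γ (≤-trans γ≤β′ β′≤β)

  barrier-compose : ∀ {k T η β} → Barrier k T η → Barrier k η β → Barrier k T β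
  barrier-compose {k} {T} {η} {β} (T≤η , guardT) (η≤β , guardη) = ≤-trans T≤η η≤β , guard
    where
    guard : ∀ γ → T < γ → γ ≤ β → T ≤ fs γ k
    guard γ T<γ γ≤β with compare γ η
    ... | tri< γ<η _ _ = guardT γ T<γ (inj₁ γ<η)
    ... | tri≈ _ refl _ = guardT γ T<γ (inj₂ refl)
    ... | tri> _ _ η<γ = ≤-trans T≤η (guardη γ η<γ γ≤β)

  fs-barrier : ∀ α {n k} → n ℕ.≤ k → 1 ℕ.≤ k → Barrier k (fs α n) α
  fs-barrier α {n} {k} n≤k 1≤k = fs-≤ α n , guard
    where
    guard : ∀ γ → fs α n < γ → γ ≤ α → fs α n ≤ fs γ k
    guard γ αₙ<γ (inj₁ γ<α) = ≤-trans (bachmann α γ n αₙ<γ γ<α) (fs-mono γ 1 k 1≤k)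
    guard γ αₙ<γ (inj₂ refl) = fs-mono α n k n≤k

  barrier-step : ∀ n {η ξ ξ′} → Barrier (suc n) η ξ → fs ξ (suc n) ≤ ξ′ → ξ′ ≤ ξ
    → Barrier (suc (suc n)) (fs η (suc n)) ξ′
  barrier-step n {η} (inj₂ refl , _) ξₙ≤ξ′ ξ′≤ξ =
    barrier-shrink ξₙ≤ξ′ ξ′≤ξ (fs-barrier η (n≤1+n (suc n)) (s≤s z≤n))
  barrier-step n {η} {ξ} {ξ′} barrier@(inj₁ η<ξ , guard) ξₙ≤ξ′ ξ′≤ξ =
    barrier-compose (fs-barrier η (n≤1+n (suc n)) (s≤s z≤n))
      (barrier-mono (n≤1+n (suc n)) (barrier-shrink η≤ξ′ ξ′≤ξ barrier))
    where
    η≤ξ′ : η ≤ ξ′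
    η≤ξ′ = ≤-trans (guard ξ η<ξ (inj₂ refl)) ξₙ≤ξ′

  iterFS-barrier : (ξ : ℕ → Carrier)
    → (∀ n → fs (ξ n) (suc n) ≤ ξ (suc n) × ξ (suc n) ≤ ξ n)
    → ∀ n → Barrier (suc n) (iterFS fs (ξ 0) n) (ξ n)
  iterFS-barrier ξ bounds ℕ.zero = barrier-refl 1 (ξ 0)
  iterFS-barrier ξ bounds (suc n) =
    barrier-step n (iterFS-barrier ξ bounds n) (proj₁ (bounds n)) (proj₂ (bounds n))

mainTheorem5 : (Λ : Ordinal) (fs : Ordinal.Carrier Λ → ℕ → Ordinal.Carrier Λ)
    → IsFundamentalSystem Λ fs → Bachmann Λ fs
    → (ξ : ℕ → Ordinal.Carrier Λ)
    → (∀ n → Ordinal._≤_ Λ (fs (ξ n) (suc n)) (ξ (suc n)) × Ordinal._≤_ Λ (ξ (suc n)) (ξ n))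
    → ∀ n → Ordinal._≤_ Λ (iterFS fs (ξ 0) n) (ξ n)
mainTheorem5 Λ fs fundamental bachmann ξ bounds n =
  proj₁ (BachmannBarriers.iterFS-barrier Λ fs fundamental bachmann ξ bounds n)
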